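{- For every $k\in\mathbb{N}$ and every positive integer $n$, $$\sum_{m=0}^{n-1}(2m+1)\binom{m+k}{2k}=\frac{n(n-k)}{k+1}\binom{n+k}{2k}.$$ -}

module Defs where

open import Data.Nat using (ℕ; zero; suc; _+_; _*_)

sumBelow : ℕ → (ℕ → ℕ) → ℕ
sumBelow zero    f = 0
sumBelow (suc n) f = sumBelow n f + f n

module Submission where

-- Write  S k n = Σ_{m<n} (2m+1)·C(m+k,2k)  and  c k n = C(n+k,2k).  Over ℕ we prove the
-- subtraction-free form
--     (k+1)·S k n + n·k·c k n = n²·c k n                                (★)
-- by induction on n.  The induction step needs one relation between
-- consecutive values of c, obtained from Pascal's rule and the absorption
-- identity  (r+1)·C(N+1,r+1) = (N+1)·C(N,r):
--     (N+1)·C(N+1,r) = r·C(N+1,r) + (N+1)·C(N,r),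
-- used with N = n+k and r = 2k.  Given this, the step is pure commutative
-- semiring algebra (checked by the ring solver after cancelling a common term).
-- Finally (★) is transported to ℤ, where subtracting n·k·c gives
-- (k+1)·S = n(n-k)·c uniformly in k (integer subtraction needs no case split
-- on k ≤ n), and this cross-multiplied equation is exactly equality of the two
-- fractions in ℚ.

open import Defs
open import Data.Nat using (ℕ; suc; _+_; _*_; NonZero)
open import Data.Nat.Combinatorics using (_C_)
open import Data.Integer as ℤ using (ℤ; +_)
open import Data.Rational using (ℚ; _/_)
open import Relation.Binary.PropositionalEquality using (_≡_)

open import Data.Nat using (zero)
open import Data.Nat.Properties using (*-zeroʳ; *-identityʳ; +-identityʳ; *-distribˡ-+; +-assoc; +-cancelʳ-≡)
open import Data.Nat.Combinatorics using (nC1≡n; nCk+nC[k+1]≡[n+1]C[k+1])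
open import Data.Nat.Solver using (module +-*-Solver)
import Data.Integer.Properties as ℤ
import Data.Integer.Solver as ℤSolver
open import Data.Rational.Properties using (fromℚᵘ-cong)
open import Data.Rational.Unnormalised using (mkℚᵘ; *≡*)
open import Relation.Binary.PropositionalEquality using (refl; sym; trans; cong; cong₂; module ≡-Reasoning)

absorption : ∀ N r → suc r * (suc N C suc r) ≡ suc N * (N C r)
absorption zero    zero    = refl
absorption zero    (suc r) = *-zeroʳ (suc (suc r))
absorption (suc M) zero    =
  trans (+-identityʳ _) (trans (nC1≡n (suc (suc M))) (sym (*-identityʳ (suc (suc M)))))
absorption (suc M) (suc s) = begin
    suc (suc s) * (suc (suc M) C suc (suc s))
      ≡⟨ cong (suc (suc s) *_) (sym (nCk+nC[k+1]≡[n+1]C[k+1] (suc M) (suc s))) ⟩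
    suc (suc s) * (a + b)
      ≡⟨ solve 3 (λ s a b → (con 2 :+ s) :* (a :+ b) := (con 1 :+ s) :* a :+ a :+ (con 2 :+ s) :* b) refl s a b ⟩
    suc s * a + a + suc (suc s) * b
      ≡⟨ cong₂ (λ x y → x + a + y) (absorption M s) (absorption M (suc s)) ⟩
    suc M * (M C s) + a + suc M * (M C suc s)
      ≡⟨ solve 4 (λ m x a y → (con 1 :+ m) :* x :+ a :+ (con 1 :+ m) :* y := (con 1 :+ m) :* (x :+ y) :+ a) refl M (M C s) a (M C suc s) ⟩
    suc M * (M C s + M C suc s) + a
      ≡⟨ cong (λ x → suc M * x + a) (nCk+nC[k+1]≡[n+1]C[k+1] M s) ⟩
    suc M * a + a
      ≡⟨ solve 2 (λ m a → (con 1 :+ m) :* a :+ a := (con 2 :+ m) :* a) refl M a ⟩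
    suc (suc M) * a ∎
  where
  open ≡-Reasoning
  open +-*-Solver
  a = suc M C suc s
  b = suc M C suc (suc s)

-- Splitting (N+1)·C(N+1,r) along Pascal's rule and absorbing the first part:
-- (N+1)·C(N+1,r) = r·C(N+1,r) + (N+1)·C(N,r).
scaled-pascal : ∀ N r → suc N * (suc N C r) ≡ r * (suc N C r) + suc N * (N C r)
scaled-pascal N zero    = refl
scaled-pascal N (suc s) = begin
    suc N * (suc N C suc s)
      ≡⟨ cong (suc N *_) (sym (nCk+nC[k+1]≡[n+1]C[k+1] N s)) ⟩
    suc N * (N C s + N C suc s)
      ≡⟨ *-distribˡ-+ (suc N) (N C s) (N C suc s) ⟩
    suc N * (N C s) + suc N * (N C suc s)
      ≡⟨ cong (_+ suc N * (N C suc s)) (sym (absorption N s)) ⟩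
    suc s * (suc N C suc s) + suc N * (N C suc s) ∎
  where open ≡-Reasoning

-- The algebraic content of the induction step for (★): if S and c satisfy (★)
-- at n, and c' = C(n+1+k,2k) is related to c by scaled-pascal, then
-- S + (2n+1)·c and c' satisfy (★) at n+1.  Both sides are compared after adding
-- the common term E, which turns the claim into a ring identity plus the two
-- hypotheses.
step-identity : ∀ k n S c c' →
  suc k * S + n * k * c ≡ n * n * c →
  suc (n + k) * c' ≡ (2 * k) * c' + suc (n + k) * c →
  suc k * (S + (2 * n + 1) * c) + suc n * k * c' ≡ suc n * suc n * c'
step-identity k n S c c' ih pascal = +-cancelʳ-≡ E _ _ (begin
    L + E
      ≡⟨ solve 5 (λ k n S c c' →
            ((con 1 :+ k) :* (S :+ (con 2 :* n :+ con 1) :* c) :+ (con 1 :+ n) :* k :* c')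
              :+ (n :* n :* c :+ (con 1 :+ n) :* ((con 1 :+ (n :+ k)) :* c'))
          := (con 1 :+ n) :* (con 1 :+ n) :* c'
              :+ ((con 1 :+ k) :* S :+ n :* k :* c)
              :+ (con 1 :+ n) :* ((con 2 :* k) :* c' :+ (con 1 :+ (n :+ k)) :* c)) refl k n S c c' ⟩
    R + (suc k * S + n * k * c) + suc n * ((2 * k) * c' + suc (n + k) * c)
      ≡⟨ cong₂ (λ x y → R + x + suc n * y) ih (sym pascal) ⟩
    R + n * n * c + suc n * (suc (n + k) * c')
      ≡⟨ +-assoc R _ _ ⟩
    R + E ∎)
  where
  open ≡-Reasoning
  open +-*-Solver
  L = suc k * (S + (2 * n + 1) * c) + suc n * k * c'
  R = suc n * suc n * c'
  E = n * n * c + suc n * (suc (n + k) * c')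

term : ℕ → ℕ → ℕ
term k m = (2 * m + 1) * ((m + k) C (2 * k))

scaled-sum : ∀ k n →
  suc k * sumBelow n (term k) + n * k * ((n + k) C (2 * k)) ≡ n * n * ((n + k) C (2 * k))
scaled-sum k zero    = trans (+-identityʳ _) (*-zeroʳ (suc k))
scaled-sum k (suc n) =
  step-identity k n (sumBelow n (term k)) ((n + k) C (2 * k)) ((suc n + k) C (2 * k))
    (scaled-sum k n) (scaled-pascal (n + k) (2 * k))

pos-*³ : ∀ a b c → + (a * b * c) ≡ + a ℤ.* + b ℤ.* + c
pos-*³ a b c = trans (ℤ.pos-* (a * b) c) (cong (ℤ._* + c) (ℤ.pos-* a b))

-- The cross-multiplied form of the theorem, over ℤ: (★) minus n·k·c.
cross-multiplied : ∀ k n →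
  + sumBelow n (term k) ℤ.* + suc k
    ≡ (+ n ℤ.* (+ n ℤ.- + k) ℤ.* + ((n + k) C (2 * k))) ℤ.* + 1
cross-multiplied k n = begin
    S′ ℤ.* K′
      ≡⟨ solve 5 (λ S K N k c → S :* K := (K :* S :+ N :* k :* c) :- N :* k :* c) refl S′ K′ N k′ c′ ⟩
    (K′ ℤ.* S′ ℤ.+ N ℤ.* k′ ℤ.* c′) ℤ.- N ℤ.* k′ ℤ.* c′
      ≡⟨ cong (ℤ._- N ℤ.* k′ ℤ.* c′) cast-★ ⟩
    + (n * n * c) ℤ.- N ℤ.* k′ ℤ.* c′
      ≡⟨ cong (ℤ._- N ℤ.* k′ ℤ.* c′) (pos-*³ n n c) ⟩
    N ℤ.* N ℤ.* c′ ℤ.- N ℤ.* k′ ℤ.* c′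
      ≡⟨ solve 3 (λ N k c → N :* N :* c :- N :* k :* c := N :* (N :- k) :* c :* con (+ 1)) refl N k′ c′ ⟩
    N ℤ.* (N ℤ.- k′) ℤ.* c′ ℤ.* + 1 ∎
  where
  open ≡-Reasoning
  open ℤSolver.+-*-Solver
  S = sumBelow n (term k)
  c = (n + k) C (2 * k)
  S′ = + S
  K′ = + suc k
  N = + n
  k′ = + k
  c′ = + c
  cast-★ : K′ ℤ.* S′ ℤ.+ N ℤ.* k′ ℤ.* c′ ≡ + (n * n * c)
  cast-★ = begin
    K′ ℤ.* S′ ℤ.+ N ℤ.* k′ ℤ.* c′
      ≡⟨ cong₂ ℤ._+_ (sym (ℤ.pos-* (suc k) S)) (sym (pos-*³ n k c)) ⟩
    + (suc k * S) ℤ.+ + (n * k * c)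
      ≡⟨ sym (ℤ.pos-+ (suc k * S) (n * k * c)) ⟩
    + (suc k * S + n * k * c)
      ≡⟨ cong +_ (scaled-sum k n) ⟩
    + (n * n * c) ∎

-- Σ_{m<n} (2m+1)·C(m+k,2k) = n(n-k)/(k+1) · C(n+k,2k) in ℚ: both sides are
-- normalisations of unnormalised fractions whose cross products agree.
lemma4p2 : (k n : ℕ) → .{{_ : NonZero n}} →
    (+ sumBelow n (λ m → (2 * m + 1) * ((m + k) C (2 * k)))) / 1
    ≡ ((+ n ℤ.* (+ n ℤ.- + k) ℤ.* + ((n + k) C (2 * k))) / suc k)
lemma4p2 k n = fromℚᵘ-cong {mkℚᵘ (+ sumBelow n (term k)) 0}
  {mkℚᵘ (+ n ℤ.* (+ n ℤ.- + k) ℤ.* + ((n + k) C (2 * k))) k} (*≡* (cross-multiplied k n))
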